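{- Let $G$ be a nontrivial simple connected graph and $w\in V(G)$. For nonnegative integers $p,q$, let $G(p,q)$ denote the graph obtained from $G$ by attaching to $w$ two pendant paths $wv_1v_2\cdots v_p$ and $wu_1u_2\cdots u_q$ of lengths $p$ and $q$ respectively (the $v_i$ and $u_j$ being new distinct vertices). If $p\geq q\geq 1$, then $\xi^{ce}(G(p,q))\geq \xi^{ce}(G(p+1,q-1))$.
   Context: For a vertex $x$ of a connected graph $H$, $d_H(x)$ is its degree and $\varepsilon_H(x)=\max_{y\in V(H)} d(x,y)$ is its eccentricity (maximum distance to another vertex). The connective eccentricity index is $\xi^{ce}(H)=\sum_{x\in V(H)}\frac{d_H(x)}{\varepsilon_H(x)}$. -}

module Defs where

open import Data.Bool using (Bool; true; false; if_then_else_; _∧_; _∨_)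
open import Data.Nat using (ℕ; zero; suc; _⊔_; _≤_; _+_)
open import Data.Nat.Properties using (_≟_)
open import Data.Fin as F using (Fin; toℕ; splitAt)
open import Data.Fin.Properties using () renaming (_≟_ to _≟F_)
open import Data.List using (List; allFin; map; foldr)
open import Data.Bool.ListAction using (any)
open import Data.Nat.ListAction using (sum)
open import Data.Sum using (_⊎_; inj₁; inj₂)
open import Data.Product using (∃)
open import Data.Integer using (+_)
open import Data.Rational using (ℚ; 0ℚ; _/_) renaming (_+_ to _+ℚ_)
open import Relation.Nullary.Decidable using (⌊_⌋)
open import Relation.Binary.PropositionalEquality using (_≡_)

Adj : ℕ → Set
Adj n = Fin n → Fin n → Bool

Symmetric : ∀ {n} → Adj n → Set
Symmetric {n} a = (x y : Fin n) → a x y ≡ a y x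

Loopless : ∀ {n} → Adj n → Set
Loopless {n} a = (x : Fin n) → a x x ≡ false

reach : ∀ {n} → Adj n → ℕ → Fin n → Fin n → Bool
reach a zero    x y = ⌊ x ≟F y ⌋
reach {n} a (suc k) x y = reach a k x y ∨ any (λ z → reach a k x z ∧ a z y) (allFin n)

Connected : ∀ {n} → Adj n → Set
Connected {n} a = (x y : Fin n) → ∃ λ k → reach a k x y ≡ true

-- least k < b with f k = true (b if none)
search : (ℕ → Bool) → ℕ → ℕ
search f zero    = zero
search f (suc b) = if f zero then zero else suc (search (λ k → f (suc k)) b)

-- graph distance (in a connected graph on n vertices it is < n, so the search is exhaustive)
dist : ∀ {n} → Adj n → Fin n → Fin n → ℕ
dist {n} a x y = search (λ k → reach a k x y) n

ecc : ∀ {n} → Adj n → Fin n → ℕ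
ecc {n} a x = foldr _⊔_ 0 (map (dist a x) (allFin n))

deg : ∀ {n} → Adj n → Fin n → ℕ
deg {n} a x = sum (map (λ y → if a x y then 1 else 0) (allFin n))

-- d / e as a rational (e = 0 only for the trivial graph; convention 0 there)
frac : ℕ → ℕ → ℚ
frac d zero    = 0ℚ
frac d (suc e) = (+ d) / suc e

ξce : ∀ {n} → Adj n → ℚ
ξce {n} a = foldr _+ℚ_ 0ℚ (map (λ x → frac (deg a x) (ecc a x)) (allFin n))

-- G(p,q): vertices Fin (n + (p + q)); Fin n are the old vertices,
-- then v₁..v_p (indices 0..p-1), then u₁..u_q (indices 0..q-1).
-- Edges: old edges, w–v₁, vᵢ–vᵢ₊₁, w–u₁, uⱼ–uⱼ₊₁.
data Kind (n p q : ℕ) : Set where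
  old : Fin n → Kind n p q
  vv  : Fin p → Kind n p q
  uu  : Fin q → Kind n p q

kind : ∀ {n} p q → Fin (n + (p + q)) → Kind n p q
kind {n} p q x with splitAt n x
... | inj₁ o = old o
... | inj₂ r with splitAt p r
...   | inj₁ i = vv i
...   | inj₂ j = uu j

consec : ℕ → ℕ → Bool
consec i j = ⌊ suc i ≟ j ⌋ ∨ ⌊ suc j ≟ i ⌋

isFirst : ∀ {m} → Fin m → Bool
isFirst i = ⌊ toℕ i ≟ 0 ⌋

kadj : ∀ {n p q} → Adj n → Fin n → Kind n p q → Kind n p q → Bool
kadj a w (old x) (old y) = a x y
kadj a w (old x) (vv i)  = ⌊ x ≟F w ⌋ ∧ isFirst i
kadj a w (vv i)  (old x) = ⌊ x ≟F w ⌋ ∧ isFirst i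
kadj a w (old x) (uu j)  = ⌊ x ≟F w ⌋ ∧ isFirst j
kadj a w (uu j)  (old x) = ⌊ x ≟F w ⌋ ∧ isFirst j
kadj a w (vv i)  (vv j)  = consec (toℕ i) (toℕ j)
kadj a w (uu i)  (uu j)  = consec (toℕ i) (toℕ j)
kadj a w (vv i)  (uu j)  = false
kadj a w (uu j)  (vv i)  = false

attach : ∀ {n} → Adj n → Fin n → (p q : ℕ) → Adj (n + (p + q))
attach a w p q x y = kadj a w (kind p q x) (kind p q y)

module Submission where

-- The two pendant paths of G(p, q) form one line 0 … L, L = p + q, through w at position q, and
-- G(p + 1, q − 1) is the same line hung at q − 1. Distances are explicit: a vertex at position s
-- reaches the host through w, at |s − q| plus its distance from w, and the far end of the line at
-- max(s, L − s). So ξce splits into a host part, which depends only on the longer arm max(p, q) and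
-- decreases as it grows, and a line part. Moving the attachment point from q to q − 1 lowers the
-- line part: pair each position s < q with its mirror image 2q − 1 − s; within a pair the larger
-- host distance moves to the vertex of smaller degree and larger far distance, and every position
-- beyond 2q only gets farther from the host.

open import Defs
open import Data.Nat using (ℕ; suc; _≤_)
open import Data.Fin using (Fin)
open import Data.Rational using (_≥_)

open import Algebra.Bundles using (CommutativeMonoid)
open import Algebra.Core using (Op₂)
open import Algebra.Structures using (IsCommutativeMonoid)
import Algebra.Properties.CommutativeMonoid.Sum as CommutativeMonoidSum
open import Data.Bool using (Bool; true; false; T; if_then_else_; _∧_; _∨_)
open import Data.Bool.Properties using (T-∧; T-∨; ∧-zeroʳ)
open import Data.Empty using (⊥-elim)
open import Data.Fin as F using (toℕ; _↑ˡ_; _↑ʳ_; splitAt)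
import Data.Fin.Properties as FP
open import Data.Integer as ℤ using (ℤ)
import Data.Integer.Properties as ℤP
open import Data.Integer.Tactic.RingSolver using (solve-∀)
open import Data.List using (foldr; map; tabulate; allFin)
import Data.List.Properties as LP
open import Data.List.Membership.Propositional using (lose)
open import Data.List.Membership.Propositional.Properties using (∈-allFin)
open import Data.List.Relation.Unary.Any using (satisfied)
open import Data.List.Relation.Unary.Any.Properties using (any⁺; any⁻)
import Data.Nat as ℕ
open import Data.Nat using (_≟_; zero; _+_; _∸_; _⊔_; _⊓_; _<_; z≤n; s≤s; ∣_-_∣)
import Data.Nat.Properties as NP
open import Data.Product using (Σ; ∃; _×_; _,_; proj₁; proj₂)
open import Data.Rational as ℚ using (ℚ; 0ℚ)
import Data.Rational.Properties as ℚP
open import Data.Rational.Unnormalised as ℚᵘ using (mkℚᵘ; *≡*; *≤*)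
import Data.Rational.Unnormalised.Properties as ℚᵘP
open import Data.Sum using (_⊎_; inj₁; inj₂)
open import Data.Unit using (⊤; tt)
open import Level using (0ℓ)
open import Function using (_∘_; id; _⇔_; mk⇔; Equivalence)
open import Relation.Binary using (_Preserves_⟶_; tri<; tri≈; tri>)
open import Relation.Binary.PropositionalEquality
open import Relation.Nullary using (¬_; yes; no; contradiction)
open import Relation.Nullary.Decidable using (⌊_⌋; toWitness; fromWitness)

module FiniteSum {A : Set} {_∙_ : Op₂ A} {ε : A}
                 (isCM : IsCommutativeMonoid _≡_ _∙_ ε) where

  open IsCommutativeMonoid isCM using (assoc; identityˡ; identityʳ; comm)

  commutativeMonoid : CommutativeMonoid 0ℓ 0ℓ
  commutativeMonoid = record { isCommutativeMonoid = isCM }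

  open CommutativeMonoidSum commutativeMonoid public
    using (sum; sum-cong-≗; ∑-distrib-+; sum-replicate-zero)
  open CommutativeMonoidSum commutativeMonoid
    using (sum-remove)

  foldr-allFin : ∀ {k} (f : Fin k → A) → foldr _∙_ ε (map f (allFin k)) ≡ sum f
  foldr-allFin {k} f = trans (cong (foldr _∙_ ε) (LP.map-tabulate id f)) (foldr-tabulate f)
    where
    foldr-tabulate : ∀ {k} (g : Fin k → A) → foldr _∙_ ε (tabulate g) ≡ sum g
    foldr-tabulate {zero}  g = refl
    foldr-tabulate {suc k} g = cong (g F.zero ∙_) (foldr-tabulate (g ∘ F.suc))

  sum-↑ : ∀ n m (f : Fin (n + m) → A) →
          sum f ≡ sum (λ i → f (i ↑ˡ m)) ∙ sum (λ j → f (n ↑ʳ j))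
  sum-↑ zero    m f = sym (identityˡ _)
  sum-↑ (suc n) m f = trans (cong (f F.zero ∙_) (sum-↑ n m (f ∘ F.suc))) (sym (assoc _ _ _))

  sum-concentrated : ∀ {k} (f : Fin k → A) (u : Fin k) →
                     (∀ x → x ≢ u → f x ≡ ε) → sum f ≡ f u
  sum-concentrated {suc k} f u off-u = begin
    sum f                                ≡⟨ sum-remove f ⟩
    f u ∙ sum (f ∘ F.punchIn u)          ≡⟨ cong (f u ∙_) (sum-cong-≗ (λ j → off-u _ (FP.punchInᵢ≢i u j))) ⟩
    f u ∙ sum {k} (λ _ → ε)              ≡⟨ cong (f u ∙_) (sum-replicate-zero k) ⟩
    f u ∙ ε                              ≡⟨ identityʳ (f u) ⟩
    f u                                  ∎
    where open ≡-Reasoning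

  sum< : ℕ → (ℕ → A) → A
  sum< k g = sum {k} (g ∘ toℕ)

  sum<-cong : ∀ k {f g : ℕ → A} → (∀ i → i < k → f i ≡ g i) → sum< k f ≡ sum< k g
  sum<-cong k f≗g = sum-cong-≗ (λ i → f≗g (toℕ i) (FP.toℕ<n i))

  sum<-+ : ∀ a b (g : ℕ → A) → sum< (a + b) g ≡ sum< a g ∙ sum< b (λ i → g (a + i))
  sum<-+ zero    b g = sym (identityˡ _)
  sum<-+ (suc a) b g = trans (cong (g 0 ∙_) (sum<-+ a b (g ∘ suc))) (sym (assoc _ _ _))

  sum<-reverse : ∀ k (g : ℕ → A) → sum< k (λ j → g (k ∸ suc j)) ≡ sum< k g
  sum<-reverse zero    g = refl
  sum<-reverse (suc k) g = begin
    g k ∙ sum< k (λ j → g (k ∸ suc j))  ≡⟨ cong (g k ∙_) (sum<-reverse k g) ⟩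
    g k ∙ sum< k g                      ≡⟨ comm _ _ ⟩
    sum< k g ∙ g k                      ≡⟨ cong (λ t → sum< k g ∙ t) last-term ⟨
    sum< k g ∙ sum< 1 (λ i → g (k + i)) ≡⟨ sum<-+ k 1 g ⟨
    sum< (k + 1) g                      ≡⟨ cong (λ t → sum< t g) (NP.+-comm k 1) ⟩
    sum< (suc k) g                      ∎
    where
    open ≡-Reasoning
    last-term : g (k + 0) ∙ ε ≡ g k
    last-term = trans (identityʳ _) (cong g (NP.+-identityʳ k))

  sum<-mirror : ∀ c k (g : ℕ → A) →
                sum< (c + (c + k)) g ≡ sum< c (λ s → g s ∙ g (c + (c ∸ suc s))) ∙ sum< k (λ i → g (c + (c + i)))
  sum<-mirror c k g = begin
      sum< (c + (c + k)) g
    ≡⟨ sum<-+ c (c + k) g ⟩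
      sum< c g ∙ sum< (c + k) (λ i → g (c + i))
    ≡⟨ cong (sum< c g ∙_) (sum<-+ c k (λ i → g (c + i))) ⟩
      sum< c g ∙ (sum< c (λ i → g (c + i)) ∙ rest)
    ≡⟨ assoc (sum< c g) (sum< c (λ i → g (c + i))) rest ⟨
      (sum< c g ∙ sum< c (λ i → g (c + i))) ∙ rest
    ≡⟨ cong (λ u → (sum< c g ∙ u) ∙ rest) (sum<-reverse c (λ i → g (c + i))) ⟨
      (sum< c g ∙ sum< c (λ s → g (c + (c ∸ suc s)))) ∙ rest
    ≡⟨ cong (_∙ rest) (∑-distrib-+ {c} (g ∘ toℕ) (λ s → g (c + (c ∸ suc (toℕ s))))) ⟨
      sum< c (λ s → g s ∙ g (c + (c ∸ suc s))) ∙ rest ∎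
    where
    open ≡-Reasoning
    rest : A
    rest = sum< k (λ i → g (c + (c + i)))

module Σℕ = FiniteSum NP.+-0-isCommutativeMonoid
module Max = FiniteSum NP.⊔-0-isCommutativeMonoid
module Σℚ = FiniteSum ℚP.+-0-isCommutativeMonoid

max-upper : ∀ {k} (f : Fin k → ℕ) i → f i ≤ Max.sum f
max-upper f F.zero    = NP.m≤m⊔n _ _
max-upper f (F.suc i) = NP.≤-trans (max-upper (f ∘ F.suc) i) (NP.m≤n⊔m _ _)

max-least : ∀ {k} (f : Fin k → ℕ) {B} → (∀ i → f i ≤ B) → Max.sum f ≤ B
max-least {zero}  f f≤B = z≤n
max-least {suc k} f f≤B = NP.⊔-lub (f≤B F.zero) (max-least (f ∘ F.suc) (f≤B ∘ F.suc))

max-distrib : ∀ {φ : ℕ → ℕ} → φ Preserves _≤_ ⟶ _≤_ →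
              ∀ {k} → Fin k → (f : Fin k → ℕ) → Max.sum (φ ∘ f) ≡ φ (Max.sum f)
max-distrib {φ} mono {suc zero}    _ f = trans (NP.⊔-identityʳ _) (cong φ (sym (NP.⊔-identityʳ _)))
max-distrib {φ} mono {suc (suc k)} _ f =
  trans (cong (φ (f F.zero) ⊔_) (max-distrib mono F.zero (f ∘ F.suc)))
        (sym (NP.mono-≤-distrib-⊔ mono (f F.zero) _))

max<-upper : ∀ k (g : ℕ → ℕ) {u} → u < k → g u ≤ Max.sum< k g
max<-upper k g u<k =
  subst (λ t → g t ≤ Max.sum< k g) (FP.toℕ-fromℕ< u<k) (max-upper (g ∘ toℕ) (F.fromℕ< u<k))

max<-∣-∣ : ∀ {c L} → c ≤ L → Max.sum< (suc L) (λ t → ∣ t - c ∣) ≡ c ⊔ (L ∸ c)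
max<-∣-∣ {c} {L} c≤L = NP.≤-antisym
  (max-least _ (λ t → bound (toℕ t) (NP.≤-pred (FP.toℕ<n t))))
  (NP.⊔-lub (subst (_≤ Max.sum< (suc L) dc) (NP.∣-∣-identityˡ c) (max<-upper (suc L) dc (s≤s z≤n)))
            (subst (_≤ Max.sum< (suc L) dc) (NP.m≤n⇒∣n-m∣≡n∸m c≤L) (max<-upper (suc L) dc NP.≤-refl)))
  where
  dc : ℕ → ℕ
  dc t = ∣ t - c ∣
  bound : ∀ t → t ≤ L → ∣ t - c ∣ ≤ c ⊔ (L ∸ c)
  bound t t≤L with NP.∣m-n∣≡[m∸n]∨[n∸m] t c
  ... | inj₁ e = subst (_≤ _) (sym e) (NP.≤-trans (NP.∸-monoˡ-≤ c t≤L) (NP.m≤n⊔m c _))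
  ... | inj₂ e = subst (_≤ _) (sym e) (NP.≤-trans (NP.m∸n≤m c t) (NP.m≤m⊔n c _))

T-injective : ∀ {b c} → (T b → T c) → (T c → T b) → b ≡ c
T-injective {false} {false} _   _   = refl
T-injective {false} {true}  _   c⇒b = ⊥-elim (c⇒b _)
T-injective {true}  {false} b⇒c _   = ⊥-elim (b⇒c _)
T-injective {true}  {true}  _   _   = refl

¬T⇒≡false : ∀ {b} → ¬ T b → b ≡ false
¬T⇒≡false {false} _  = refl
¬T⇒≡false {true}  ¬t = ⊥-elim (¬t _)

indicator : Bool → ℕ
indicator b = if b then 1 else 0

indicator-∨ : ∀ b c → indicator (b ∨ c) ≤ indicator b + indicator c
indicator-∨ false c = NP.≤-refl
indicator-∨ true  c = s≤s z≤n

Σℕ-mono : ∀ {k} (f g : Fin k → ℕ) → (∀ i → f i ≤ g i) → Σℕ.sum f ≤ Σℕ.sum g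
Σℕ-mono {zero}  f g f≤g = z≤n
Σℕ-mono {suc k} f g f≤g = NP.+-mono-≤ (f≤g F.zero) (Σℕ-mono (f ∘ F.suc) (g ∘ F.suc) (f≤g ∘ F.suc))

Σℕ<-term : ∀ k (g : ℕ → ℕ) {u} → u < k → g u ≤ Σℕ.sum< k g
Σℕ<-term (suc k) g {zero}  _         = NP.m≤m+n _ _
Σℕ<-term (suc k) g {suc u} (s≤s u<k) = NP.≤-trans (Σℕ<-term k (g ∘ suc) u<k) (NP.m≤n+m _ _)

Σℕ<-two-terms : ∀ k (g : ℕ → ℕ) {u v} → u < v → v < k → g u + g v ≤ Σℕ.sum< k g
Σℕ<-two-terms (suc k) g {zero}  {suc v} _         (s≤s v<k) = NP.+-monoʳ-≤ (g 0) (Σℕ<-term k (g ∘ suc) v<k)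
Σℕ<-two-terms (suc k) g {suc u} {suc v} (s≤s u<v) (s≤s v<k) =
  NP.≤-trans (Σℕ<-two-terms k (g ∘ suc) u<v v<k) (NP.m≤n+m _ _)

Σℕ<-indicator-≤1 : ∀ k (f : ℕ → Bool) → (∀ {t t'} → T (f t) → T (f t') → t ≡ t') →
                   Σℕ.sum< k (indicator ∘ f) ≤ 1
Σℕ<-indicator-≤1 zero    f unique = z≤n
Σℕ<-indicator-≤1 (suc k) f unique with f 0 in f0
... | false = Σℕ<-indicator-≤1 k (f ∘ suc) (λ ft ft' → NP.suc-injective (unique ft ft'))
... | true  = s≤s (NP.≤-reflexive (trans (Σℕ.sum<-cong k rest-false) (Σℕ.sum-replicate-zero k)))
  where
  rest-false : ∀ t → t < k → indicator (f (suc t)) ≡ 0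
  rest-false t _ with f (suc t) in ft
  ... | false = refl
  ... | true  with unique (subst T (sym ft) _) (subst T (sym f0) _)
  ...   | ()

Σℚ-mono : ∀ {k} (f g : Fin k → ℚ) → (∀ i → f i ℚ.≤ g i) → Σℚ.sum f ℚ.≤ Σℚ.sum g
Σℚ-mono {zero}  f g f≤g = ℚP.≤-refl
Σℚ-mono {suc k} f g f≤g = ℚP.+-mono-≤ (f≤g F.zero) (Σℚ-mono (f ∘ F.suc) (g ∘ F.suc) (f≤g ∘ F.suc))

Σℚ<-mono : ∀ k (f g : ℕ → ℚ) → (∀ t → t < k → f t ℚ.≤ g t) → Σℚ.sum< k f ℚ.≤ Σℚ.sum< k g
Σℚ<-mono k f g f≤g = Σℚ-mono (f ∘ toℕ) (g ∘ toℕ) (λ i → f≤g (toℕ i) (FP.toℕ<n i))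

private
  frac-≃ : ∀ d e → ℚ.toℚᵘ (frac d (suc e)) ℚᵘ.≃ mkℚᵘ (ℤ.+ d) e
  frac-≃ d e = ℚP.toℚᵘ-fromℚᵘ (mkℚᵘ (ℤ.+ d) e)

frac-0 : ∀ e → frac 0 e ≡ 0ℚ
frac-0 zero    = refl
frac-0 (suc e) = ℚP.toℚᵘ-injective (ℚᵘP.≃-trans (frac-≃ 0 e) (*≡* refl))

frac-+ : ∀ a b e → frac (a + b) e ≡ frac a e ℚ.+ frac b e
frac-+ a b zero    = sym (ℚP.+-identityʳ 0ℚ)
frac-+ a b (suc e) = ℚP.toℚᵘ-injective (begin
    ℚ.toℚᵘ (frac (a + b) (suc e))                      ≈⟨ frac-≃ (a + b) e ⟩
    mkℚᵘ (ℤ.+ (a + b)) e                                ≈⟨ *≡* numerators ⟩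
    mkℚᵘ (ℤ.+ a) e ℚᵘ.+ mkℚᵘ (ℤ.+ b) e                    ≈⟨ ℚᵘP.+-cong (frac-≃ a e) (frac-≃ b e) ⟨
    ℚ.toℚᵘ (frac a (suc e)) ℚᵘ.+ ℚ.toℚᵘ (frac b (suc e)) ≈⟨ ℚP.toℚᵘ-homo-+ (frac a (suc e)) (frac b (suc e)) ⟨
    ℚ.toℚᵘ (frac a (suc e) ℚ.+ frac b (suc e))          ∎)
  where
  open ℚᵘP.≃-Reasoning
  distrib : ∀ (x y z : ℤ) → (x ℤ.+ y) ℤ.* (z ℤ.* z) ≡ (x ℤ.* z ℤ.+ y ℤ.* z) ℤ.* z
  distrib = solve-∀
  numerators : ℤ.+ (a + b) ℤ.* ℤ.+ (suc e ℕ.* suc e) ≡ (ℤ.+ a ℤ.* ℤ.+ suc e ℤ.+ ℤ.+ b ℤ.* ℤ.+ suc e) ℤ.* ℤ.+ suc e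
  numerators = trans (cong₂ ℤ._*_ (ℤP.pos-+ a b) (ℤP.pos-* (suc e) (suc e)))
                     (distrib (ℤ.+ a) (ℤ.+ b) (ℤ.+ suc e))

frac-antitone : ∀ d {e e'} → 1 ≤ e → e ≤ e' → frac d e' ℚ.≤ frac d e
frac-antitone d {suc e} {suc e'} _ (s≤s e≤e') = ℚP.toℚᵘ-cancel-≤
  (ℚᵘP.≤-respˡ-≃ (ℚᵘP.≃-sym (frac-≃ d e')) (ℚᵘP.≤-respʳ-≃ (ℚᵘP.≃-sym (frac-≃ d e))
    (*≤* (subst₂ ℤ._≤_ (ℤP.pos-* d (suc e)) (ℤP.pos-* d (suc e'))
                       (ℤ.+≤+ (NP.*-monoʳ-≤ d (s≤s e≤e')))))))

module Walks {m : ℕ} (b : Adj m) where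

  reach-zero : ∀ {x y} → T (reach b 0 x y) → x ≡ y
  reach-zero = toWitness

  reach-suc : ∀ k {x y} → T (reach b k x y) → T (reach b (suc k) x y)
  reach-suc k r = Equivalence.from T-∨ (inj₁ r)

  reach-mono : ∀ {j k} {x y} → j ≤ k → T (reach b j x y) → T (reach b k x y)
  reach-mono {j} {x = x} {y} j≤k r with NP.m≤n⇒∃[o]m+o≡n j≤k
  ... | o , refl = extend o
    where
    extend : ∀ o → T (reach b (j + o) x y)
    extend zero    = subst (λ t → T (reach b t x y)) (sym (NP.+-identityʳ j)) r
    extend (suc o) = subst (λ t → T (reach b t x y)) (sym (NP.+-suc j o)) (reach-suc (j + o) (extend o))

  reach-refl : ∀ k x → T (reach b k x x)
  reach-refl k x = reach-mono {k = k} {x} {x} z≤n (fromWitness refl)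

  reach-step : ∀ k {x z y} → T (reach b k x z) → T (b z y) → T (reach b (suc k) x y)
  reach-step k {z = z} r e =
    Equivalence.from T-∨ (inj₂ (any⁺ _ (lose (∈-allFin z) (Equivalence.from T-∧ (r , e)))))

  reach-last-step : ∀ k {x y} → T (reach b (suc k) x y) →
                    T (reach b k x y) ⊎ ∃ λ z → T (reach b k x z) × T (b z y)
  reach-last-step k {x} {y} r with Equivalence.to T-∨ r
  ... | inj₁ r' = inj₁ r'
  ... | inj₂ r' with satisfied (any⁻ _ (allFin m) r')
  ...   | z , rz = inj₂ (z , Equivalence.to T-∧ rz)

search-≤ : ∀ f b → search f b ≤ b
search-≤ f zero    = z≤n
search-≤ f (suc b) with f 0
... | true  = z≤n
... | false = s≤s (search-≤ (f ∘ suc) b)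

search-cong : ∀ f g b → (∀ k → T (f k) → T (g k)) → (∀ k → T (g k) → T (f k)) →
              search f b ≡ search g b
search-cong f g zero    f⇒g g⇒f = refl
search-cong f g (suc b) f⇒g g⇒f rewrite T-injective (f⇒g 0) (g⇒f 0) =
  cong (λ t → if g 0 then 0 else suc t) (search-cong (f ∘ suc) (g ∘ suc) b (f⇒g ∘ suc) (g⇒f ∘ suc))

search-threshold : ∀ f d b → (∀ k → T (f k) → d ≤ k) → (∀ k → d ≤ k → T (f k)) →
                   search f b ≡ d ⊓ b
search-threshold f d       zero    _     _     = sym (NP.⊓-zeroʳ d)
search-threshold f zero    (suc b) _     above with f 0 in f0
... | true  = refl
... | false = ⊥-elim (subst T f0 (above 0 z≤n))
search-threshold f (suc d) (suc b) below above with f 0 in f0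
... | true  = ⊥-elim (NP.<⇒≱ (s≤s z≤n) (below 0 (subst T (sym f0) _)))
... | false = cong suc (search-threshold (f ∘ suc) d b (λ k fk → NP.≤-pred (below (suc k) fk))
                                                       (λ k d≤k → above (suc k) (s≤s d≤k)))

private
  search-suc : ∀ g b → search g b ≡ b ⊓ search g (suc b)
  search-suc g zero    = refl
  search-suc g (suc b) with g 0
  ... | true  = refl
  ... | false = cong suc (search-suc (g ∘ suc) b)

search-shift : ∀ f g d b → (∀ k → T (f k) → d ≤ k × T (g (k ∸ d))) →
               (∀ k → d ≤ k → T (g (k ∸ d)) → T (f k)) → search f b ≡ b ⊓ (d + search g b)
search-shift f g zero    b       f⇒g g⇒f =
  trans (search-cong f g b (λ k fk → proj₂ (f⇒g k fk)) (λ k gk → g⇒f k z≤n gk))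
        (sym (NP.m≥n⇒m⊓n≡n (search-≤ g b)))
search-shift f g (suc d) zero    f⇒g g⇒f = refl
search-shift f g (suc d) (suc b) f⇒g g⇒f with f 0 in f0
... | true  = ⊥-elim (NP.<⇒≱ (s≤s z≤n) (proj₁ (f⇒g 0 (subst T (sym f0) _))))
... | false = cong suc (begin
    search (f ∘ suc) b                  ≡⟨ search-shift (f ∘ suc) g d b
                                             (λ k fk → let d≤k , gk = f⇒g (suc k) fk in NP.≤-pred d≤k , gk)
                                             (λ k d≤k gk → g⇒f (suc k) (s≤s d≤k) gk) ⟩
    b ⊓ (d + search g b)                ≡⟨ cong (λ t → b ⊓ (d + t)) (search-suc g b) ⟩
    b ⊓ (d + (b ⊓ S))                   ≡⟨ cong (b ⊓_) (NP.+-distribˡ-⊓ d b S) ⟩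
    b ⊓ ((d + b) ⊓ (d + S))             ≡⟨ NP.⊓-assoc b (d + b) (d + S) ⟨
    (b ⊓ (d + b)) ⊓ (d + S)             ≡⟨ cong (_⊓ (d + S)) (NP.m≤n⇒m⊓n≡m (NP.m≤n+m b d)) ⟩
    b ⊓ (d + S)                         ∎)
  where
  open ≡-Reasoning
  S : ℕ
  S = search g (suc b)

∣1+n-n∣≡1 : ∀ n → ∣ suc n - n ∣ ≡ 1
∣1+n-n∣≡1 n = trans (NP.m≤n⇒∣n-m∣≡n∸m (NP.n≤1+n n)) (NP.m+n∸n≡m 1 n)

T-consec⇔ : ∀ s t → T (consec s t) ⇔ ∣ s - t ∣ ≡ 1
T-consec⇔ s t = mk⇔ (to s t ∘ Equivalence.to T-∨) (Equivalence.from T-∨ ∘ from s t)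
  where
  to : ∀ s t → T ⌊ suc s ≟ t ⌋ ⊎ T ⌊ suc t ≟ s ⌋ → ∣ s - t ∣ ≡ 1
  to s t (inj₁ s+1≡t) with toWitness s+1≡t
  ... | refl = trans (NP.∣-∣-comm s (suc s)) (∣1+n-n∣≡1 s)
  to s t (inj₂ t+1≡s) with toWitness t+1≡s
  ... | refl = ∣1+n-n∣≡1 t
  from : ∀ s t → ∣ s - t ∣ ≡ 1 → T ⌊ suc s ≟ t ⌋ ⊎ T ⌊ suc t ≟ s ⌋
  from zero    t       e = inj₁ (fromWitness (sym e))
  from (suc s) zero    e = inj₂ (fromWitness (sym e))
  from (suc s) (suc t) e with from s t e
  ... | inj₁ s+1≡t = inj₁ (fromWitness (cong suc (toWitness s+1≡t)))
  ... | inj₂ t+1≡s = inj₂ (fromWitness (cong suc (toWitness t+1≡s)))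

consec-irrefl : ∀ s → consec s s ≡ false
consec-irrefl s = ¬T⇒≡false (λ c → contradiction (trans (sym (NP.∣n-n∣≡0 s)) (Equivalence.to (T-consec⇔ s s) c)) λ ())

consec-sym : ∀ s t → T (consec s t) → T (consec t s)
consec-sym s t c = Equivalence.from (T-consec⇔ t s) (trans (NP.∣-∣-comm t s) (Equivalence.to (T-consec⇔ s t) c))

step-toward : ∀ s t k → ∣ s - t ∣ ≡ suc k →
              Σ ℕ λ t' → ∣ s - t' ∣ ≡ k × ∣ t' - t ∣ ≡ 1 × t' ≤ s ⊔ t
step-toward zero    (suc t) k e = t , NP.suc-injective e , trans (NP.∣-∣-comm t (suc t)) (∣1+n-n∣≡1 t) , NP.n≤1+n t
step-toward (suc s) zero    k e = 1 , trans (NP.∣-∣-identityʳ s) (NP.suc-injective e) , refl , s≤s z≤n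
step-toward (suc s) (suc t) k e with step-toward s t k e
... | t' , d-s , d-t , t'≤ = suc t' , d-s , d-t , s≤s t'≤

pathDeg : ℕ → ℕ → ℕ
pathDeg L s = Σℕ.sum< (suc L) (indicator ∘ consec s)

pathDeg-≤2 : ∀ L s → pathDeg L s ≤ 2
pathDeg-≤2 L s = begin
    pathDeg L s
  ≤⟨ Σℕ-mono {suc L} (indicator ∘ consec s ∘ toℕ) _ (λ t → indicator-∨ (right (toℕ t)) (left (toℕ t))) ⟩
    Σℕ.sum< (suc L) (λ t → indicator (right t) + indicator (left t))
  ≡⟨ Σℕ.∑-distrib-+ {suc L} (indicator ∘ right ∘ toℕ) (indicator ∘ left ∘ toℕ) ⟩
    Σℕ.sum< (suc L) (indicator ∘ right) + Σℕ.sum< (suc L) (indicator ∘ left)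
  ≤⟨ NP.+-mono-≤ (Σℕ<-indicator-≤1 (suc L) right unique-right) (Σℕ<-indicator-≤1 (suc L) left unique-left) ⟩
    2 ∎
  where
  open NP.≤-Reasoning
  right left : ℕ → Bool
  right t = ⌊ suc s ≟ t ⌋
  left  t = ⌊ suc t ≟ s ⌋
  unique-right : ∀ {t t'} → T (right t) → T (right t') → t ≡ t'
  unique-right r r' = trans (sym (toWitness r)) (toWitness r')
  unique-left : ∀ {t t'} → T (left t) → T (left t') → t ≡ t'
  unique-left l l' = NP.suc-injective (trans (toWitness l) (sym (toWitness l')))

pathDeg-interior : ∀ L s → 1 ≤ s → s < L → 2 ≤ pathDeg L s
pathDeg-interior L (suc s) _ s<L =
  subst (_≤ pathDeg L (suc s)) (cong₂ _+_ (neighbour (suc s) s (∣1+n-n∣≡1 s))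
                                          (neighbour (suc s) (suc (suc s)) (trans (NP.∣-∣-comm (suc s) (suc (suc s))) (∣1+n-n∣≡1 (suc s)))))
        (Σℕ<-two-terms (suc L) (indicator ∘ consec (suc s)) (NP.m<n⇒m<1+n (NP.n<1+n s)) (s≤s s<L))
  where
  neighbour : ∀ s t → ∣ s - t ∣ ≡ 1 → indicator (consec s t) ≡ 1
  neighbour s t e = cong indicator (T-injective {consec s t} {true} _ (λ _ → Equivalence.from (T-consec⇔ s t) e))

∸-suc-< : ∀ {j q} → j < q → q ∸ suc j < q
∸-suc-< {j} {suc q} (s≤s j<q) = s≤s (NP.m∸n≤m q j)

∸-suc-involutive : ∀ {s q} → s < q → q ∸ suc (q ∸ suc s) ≡ s
∸-suc-involutive {s} {suc q} (s≤s s≤q) = NP.m∸[m∸n]≡n s≤q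

join-splitAt′ : ∀ m k {i : Fin (m + k)} {e} → splitAt m i ≡ e → F.join m k e ≡ i
join-splitAt′ m k {i} split-i = trans (cong (F.join m k) (sym split-i)) (FP.join-splitAt m k i)

∣-∣-shift : ∀ x y u v → x + u ≡ y + v → ∣ u - v ∣ ≡ ∣ y - x ∣
∣-∣-shift x y u v e = begin
  ∣ u - v ∣           ≡⟨ NP.∣m+n-m+o∣≡∣n-o∣ x u v ⟨
  ∣ x + u - x + v ∣   ≡⟨ cong (λ t → ∣ t - x + v ∣) e ⟩
  ∣ y + v - x + v ∣   ≡⟨ cong₂ ∣_-_∣ (NP.+-comm y v) (NP.+-comm x v) ⟩
  ∣ v + y - v + x ∣   ≡⟨ NP.∣m+n-m+o∣≡∣n-o∣ v y x ⟩
  ∣ y - x ∣           ∎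
  where open ≡-Reasoning

consec-cong : ∀ s t s' t' → ∣ s - t ∣ ≡ ∣ s' - t' ∣ → consec s t ≡ consec s' t'
consec-cong s t s' t' e = T-injective
  (λ c → Equivalence.from (T-consec⇔ s' t') (trans (sym e) (Equivalence.to (T-consec⇔ s t) c)))
  (λ c → Equivalence.from (T-consec⇔ s t) (trans e (Equivalence.to (T-consec⇔ s' t') c)))

isFirst-consec : ∀ {m} (i : Fin m) q t → ∣ q - t ∣ ≡ suc (toℕ i) → isFirst i ≡ consec q t
isFirst-consec i q t e = T-injective
  (λ first → Equivalence.from (T-consec⇔ q t) (trans e (cong suc (toWitness first))))
  (λ c → fromWitness (NP.suc-injective (trans (sym e) (Equivalence.to (T-consec⇔ q t) c))))

∣-∣-step : ∀ x y z {k} → ∣ x - y ∣ ≤ k → ∣ y - z ∣ ≡ 1 → ∣ x - z ∣ ≤ suc k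
∣-∣-step x y z {k} x-y≤k y-z≡1 = NP.≤-trans (NP.∣-∣-triangle x y z)
  (subst (λ t → ∣ x - y ∣ + t ≤ suc k) (sym y-z≡1) (subst (_≤ suc k) (NP.+-comm 1 ∣ x - y ∣) (s≤s x-y≤k)))

module Host {n : ℕ} (a : Adj n) (w : Fin n) (N : ℕ) where

  baseDist : Fin n → Fin n → ℕ
  baseDist x y = search (λ k → reach a k x y) N

  hostEcc : ℕ
  hostEcc = Max.sum (baseDist w)

  -- Eccentricity of a host vertex when the longer arm hanging at w has length ℓ.
  baseEcc : ℕ → Fin n → ℕ
  baseEcc ℓ x = Max.sum (baseDist x) ⊔ (N ⊓ (ℓ + baseDist x w))

  baseSum : ℕ → ℚ
  baseSum ℓ = Σℚ.sum (λ x → frac (deg a x) (baseEcc ℓ x))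

  baseSum-antitone : ∀ {ℓ ℓ'} → 1 ≤ N → 1 ≤ ℓ → ℓ ≤ ℓ' → baseSum ℓ' ℚ.≤ baseSum ℓ
  baseSum-antitone {ℓ} 1≤N 1≤ℓ ℓ≤ℓ' = Σℚ-mono _ _ (λ x → frac-antitone (deg a x)
    (NP.≤-trans (NP.⊓-glb 1≤N (NP.≤-trans 1≤ℓ (NP.m≤m+n ℓ _))) (NP.m≤n⊔m _ _))
    (NP.⊔-monoʳ-≤ (Max.sum (baseDist x)) (NP.⊓-monoʳ-≤ N (NP.+-monoˡ-≤ (baseDist x w) ℓ≤ℓ'))))

⊔-absorbs : ∀ {a b} c → b ≤ a → a ⊔ c ≡ a ⊔ (b ⊔ c)
⊔-absorbs {a} {b} c b≤a = trans (cong (_⊔ c) (sym (NP.m≥n⇒m⊔n≡m b≤a))) (NP.⊔-assoc a b c)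

-- Eccentricity of position s on a line 0 … L hung at c on a host of eccentricity m:
-- the farthest vertex lies in the host or at an end of the line.
lineEcc : (N L m c s : ℕ) → ℕ
lineEcc N L m c s = (N ⊓ (∣ s - c ∣ + m)) ⊔ (N ⊓ (s ⊔ (L ∸ s)))

lineTerm : (N L m c s : ℕ) → ℚ
lineTerm N L m c s = frac (pathDeg L s) (lineEcc N L m c s)

lineSum : (N L m c : ℕ) → ℚ
lineSum N L m c = Σℚ.sum< (suc L) (lineTerm N L m c)

module Pendant {n : ℕ} (a : Adj n) (w : Fin n) (p q : ℕ) where

  L : ℕ
  L = p + q

  N : ℕ
  N = n + L

  A : Adj N
  A = attach a w p q

  unkind : Kind n p q → Fin N
  unkind (old x) = x ↑ˡ L
  unkind (vv i)  = n ↑ʳ (i ↑ˡ q)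
  unkind (uu j)  = n ↑ʳ (p ↑ʳ j)

  kind-unkind : ∀ κ → kind p q (unkind κ) ≡ κ
  kind-unkind (old x) rewrite FP.splitAt-↑ˡ n x L = refl
  kind-unkind (vv i)  rewrite FP.splitAt-↑ʳ n L (i ↑ˡ q) | FP.splitAt-↑ˡ p i q = refl
  kind-unkind (uu j)  rewrite FP.splitAt-↑ʳ n L (p ↑ʳ j) | FP.splitAt-↑ʳ p q j = refl

  unkind-kind : ∀ X → unkind (kind p q X) ≡ X
  unkind-kind X with splitAt n X in split-X
  ... | inj₁ x = join-splitAt′ n L split-X
  ... | inj₂ r with splitAt p r in split-r
  ...   | inj₁ i = trans (cong (n ↑ʳ_) (join-splitAt′ p q split-r)) (join-splitAt′ n L split-X)
  ...   | inj₂ j = trans (cong (n ↑ʳ_) (join-splitAt′ p q split-r)) (join-splitAt′ n L split-X)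

  kind-injective : ∀ {X Y} → kind p q X ≡ kind p q Y → X ≡ Y
  kind-injective {X} {Y} e = trans (sym (unkind-kind X)) (trans (cong unkind e) (unkind-kind Y))

  -- The two pendant paths are laid out on the line 0 … L, with w at position q:
  -- uⱼ₊₁ sits at q ∸ (j + 1) and vᵢ₊₁ at q + (i + 1).
  data Site : Set where
    base : Fin n → Site
    path : ℕ → Site

  posv : Fin p → ℕ
  posv i = suc (q + toℕ i)

  posu : Fin q → ℕ
  posu j = q ∸ suc (toℕ j)

  site : Kind n p q → Site
  site (old x) = base x
  site (vv i)  = path (posv i)
  site (uu j)  = path (posu j)

  siteOf : Fin N → Site
  siteOf = site ∘ kind p q

  OnGraph : Site → Set
  OnGraph (base x) = ⊤
  OnGraph (path s) = s ≤ L × s ≢ q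

  q≤L : q ≤ L
  q≤L = NP.m≤n+m q p

  posv≤L : ∀ i → posv i ≤ L
  posv≤L i = subst (posv i ≤_) (NP.+-comm q p)
               (subst (_≤ q + p) (NP.+-suc q (toℕ i)) (NP.+-monoʳ-≤ q (FP.toℕ<n i)))

  q<posv : ∀ i → q < posv i
  q<posv i = s≤s (NP.m≤m+n q (toℕ i))

  posu<q : ∀ j → posu j < q
  posu<q j = ∸-suc-< (FP.toℕ<n j)

  posu≤L : ∀ j → posu j ≤ L
  posu≤L j = NP.≤-trans (NP.<⇒≤ (posu<q j)) q≤L

  site-onGraph : ∀ κ → OnGraph (site κ)
  site-onGraph (old x) = tt
  site-onGraph (vv i)  = posv≤L i , (λ e → NP.<-irrefl (sym e) (q<posv i))
  site-onGraph (uu j)  = posu≤L j , (λ e → NP.<-irrefl e (posu<q j))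

  site-surjective : ∀ ζ → OnGraph ζ → Σ (Kind n p q) λ κ → site κ ≡ ζ
  site-surjective (base x) _ = old x , refl
  site-surjective (path s) (s≤L , s≢q) with NP.<-cmp s q
  ... | tri< s<q _ _ = uu (F.fromℕ< (∸-suc-< s<q)) ,
          cong path (trans (cong (λ t → q ∸ suc t) (FP.toℕ-fromℕ< (∸-suc-< s<q))) (∸-suc-involutive s<q))
  ... | tri≈ _ s≡q _ = contradiction s≡q s≢q
  ... | tri> _ _ q<s = vv (F.fromℕ< i<p) ,
          cong path (trans (cong (λ t → suc (q + t)) (FP.toℕ-fromℕ< i<p)) (NP.m+[n∸m]≡n q<s))
    where
    i<p : s ∸ suc q < p
    i<p = NP.+-cancelˡ-< (suc q) (s ∸ suc q) p
            (subst (_< suc q + p) (sym (NP.m+[n∸m]≡n q<s))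
              (subst (s <_) (cong suc (NP.+-comm p q)) (s≤s s≤L)))

  path-injective : ∀ {s t} → path s ≡ path t → s ≡ t
  path-injective refl = refl

  site-injective : ∀ κ κ' → site κ ≡ site κ' → κ ≡ κ'
  site-injective (old x) (old .x) refl = refl
  site-injective (vv i)  (vv j)   e    =
    cong vv (FP.toℕ-injective (NP.+-cancelˡ-≡ q _ _ (NP.suc-injective (path-injective e))))
  site-injective (uu i)  (uu j)   e    = cong uu (FP.toℕ-injective (begin
    toℕ i                  ≡⟨ ∸-suc-involutive (FP.toℕ<n i) ⟨
    q ∸ suc (posu i)       ≡⟨ cong (λ s → q ∸ suc s) (path-injective e) ⟩
    q ∸ suc (posu j)       ≡⟨ ∸-suc-involutive (FP.toℕ<n j) ⟩
    toℕ j                  ∎))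
    where open ≡-Reasoning
  site-injective (vv i)  (uu j)   e    =
    contradiction (subst (q <_) (path-injective e) (q<posv i)) (NP.<⇒≯ (posu<q j))
  site-injective (uu j)  (vv i)   e    =
    contradiction (subst (q <_) (sym (path-injective e)) (q<posv i)) (NP.<⇒≯ (posu<q j))
  site-injective (old x) (vv i)   ()
  site-injective (old x) (uu i)   ()
  site-injective (vv i)  (old x)  ()
  site-injective (uu i)  (old x)  ()

  siteAdj : Site → Site → Bool
  siteAdj (base x) (base y) = a x y
  siteAdj (base x) (path t) = ⌊ x FP.≟ w ⌋ ∧ consec q t
  siteAdj (path s) (base y) = ⌊ y FP.≟ w ⌋ ∧ consec s q
  siteAdj (path s) (path t) = consec s t

  private
    ∣q-posv∣ : ∀ i → ∣ q - posv i ∣ ≡ suc (toℕ i)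
    ∣q-posv∣ i = trans (cong (λ t → ∣ q - t ∣) (sym (NP.+-suc q (toℕ i)))) (NP.∣m-m+n∣≡n q (suc (toℕ i)))

    ∣q-posu∣ : ∀ j → ∣ q - posu j ∣ ≡ suc (toℕ j)
    ∣q-posu∣ j = trans (NP.m≤n⇒∣n-m∣≡n∸m (NP.m∸n≤m q (suc (toℕ j)))) (NP.m∸[m∸n]≡n (FP.toℕ<n j))

    ∣posv-posv∣ : ∀ i j → ∣ toℕ i - toℕ j ∣ ≡ ∣ posv i - posv j ∣
    ∣posv-posv∣ i j = sym (NP.∣m+n-m+o∣≡∣n-o∣ (suc q) (toℕ i) (toℕ j))

    ∣posu-posu∣ : ∀ i j → ∣ toℕ i - toℕ j ∣ ≡ ∣ posu i - posu j ∣
    ∣posu-posu∣ i j = sym (trans (∣-∣-shift (suc (toℕ i)) (suc (toℕ j)) (posu i) (posu j)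
                                            (trans (posu+ i) (sym (posu+ j))))
                                 (NP.∣-∣-comm (toℕ j) (toℕ i)))
      where
      posu+ : ∀ j → suc (toℕ j) + posu j ≡ q
      posu+ j = NP.m+[n∸m]≡n (FP.toℕ<n j)

    ¬consec-posv-posu : ∀ i j → ¬ T (consec (posv i) (posu j))
    ¬consec-posv-posu i j c with Equivalence.to (T-∨ {⌊ suc (posv i) ≟ posu j ⌋} {⌊ suc (posu j) ≟ posv i ⌋}) c
    ... | inj₁ e = NP.<-asym (posu<q j) (subst (q <_) (toWitness e) (NP.m<n⇒m<1+n (q<posv i)))
    ... | inj₂ e = NP.<-irrefl (toWitness e) (NP.≤-<-trans (posu<q j) (q<posv i))

  kadj≡siteAdj : ∀ κ κ' → kadj a w κ κ' ≡ siteAdj (site κ) (site κ')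
  kadj≡siteAdj (old x) (old y) = refl
  kadj≡siteAdj (old x) (vv i)  = cong (⌊ x FP.≟ w ⌋ ∧_) (isFirst-consec i q (posv i) (∣q-posv∣ i))
  kadj≡siteAdj (old x) (uu j)  = cong (⌊ x FP.≟ w ⌋ ∧_) (isFirst-consec j q (posu j) (∣q-posu∣ j))
  kadj≡siteAdj (vv i)  (old x) = cong (⌊ x FP.≟ w ⌋ ∧_)
    (trans (isFirst-consec i q (posv i) (∣q-posv∣ i)) (consec-cong q (posv i) (posv i) q (NP.∣-∣-comm q (posv i))))
  kadj≡siteAdj (uu j)  (old x) = cong (⌊ x FP.≟ w ⌋ ∧_)
    (trans (isFirst-consec j q (posu j) (∣q-posu∣ j)) (consec-cong q (posu j) (posu j) q (NP.∣-∣-comm q (posu j))))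
  kadj≡siteAdj (vv i)  (vv j)  = consec-cong (toℕ i) (toℕ j) (posv i) (posv j) (∣posv-posv∣ i j)
  kadj≡siteAdj (uu i)  (uu j)  = consec-cong (toℕ i) (toℕ j) (posu i) (posu j) (∣posu-posu∣ i j)
  kadj≡siteAdj (vv i)  (uu j)  = sym (¬T⇒≡false (¬consec-posv-posu i j))
  kadj≡siteAdj (uu j)  (vv i)  = sym (¬T⇒≡false (¬consec-posv-posu i j ∘ consec-sym (posu j) (posv i)))

  attach≡siteAdj : ∀ X Y → A X Y ≡ siteAdj (siteOf X) (siteOf Y)
  attach≡siteAdj X Y = kadj≡siteAdj (kind p q X) (kind p q Y)

  module Base = Walks a

  -- Closed form of «θ is reachable from ζ by a walk of length at most k», see reach⇔Within.
  Within : ℕ → Site → Site → Set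
  Within k (base x) (base y) = T (reach a k x y)
  Within k (base x) (path t) = ∣ t - q ∣ ≤ k × T (reach a (k ∸ ∣ t - q ∣) x w)
  Within k (path s) (base y) = ∣ s - q ∣ ≤ k × T (reach a (k ∸ ∣ s - q ∣) w y)
  Within k (path s) (path t) = ∣ s - t ∣ ≤ k

  base-path-adj : ∀ x t → T (siteAdj (base x) (path t)) → x ≡ w × ∣ q - t ∣ ≡ 1
  base-path-adj x t e with Equivalence.to (T-∧ {⌊ x FP.≟ w ⌋}) e
  ... | x≡w , c = toWitness x≡w , Equivalence.to (T-consec⇔ q t) c

  path-base-adj : ∀ s y → T (siteAdj (path s) (base y)) → y ≡ w × ∣ s - q ∣ ≡ 1
  path-base-adj s y e with Equivalence.to (T-∧ {⌊ y FP.≟ w ⌋}) e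
  ... | y≡w , c = toWitness y≡w , Equivalence.to (T-consec⇔ s q) c

  Within-suc : ∀ k ζ θ → Within k ζ θ → Within (suc k) ζ θ
  Within-suc k (base x) (base y) r              = Base.reach-suc k r
  Within-suc k (base x) (path t) (d≤k , r)      =
    NP.m≤n⇒m≤1+n d≤k , Base.reach-mono (NP.∸-monoˡ-≤ ∣ t - q ∣ (NP.n≤1+n k)) r
  Within-suc k (path s) (base y) (d≤k , r)      =
    NP.m≤n⇒m≤1+n d≤k , Base.reach-mono (NP.∸-monoˡ-≤ ∣ s - q ∣ (NP.n≤1+n k)) r
  Within-suc k (path s) (path t) d≤k            = NP.m≤n⇒m≤1+n d≤k

  Within-refl : ∀ ζ → Within 0 ζ ζ
  Within-refl (base x) = Base.reach-refl 0 x
  Within-refl (path s) = NP.≤-reflexive (NP.∣n-n∣≡0 s)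

  Within-zero : ∀ ζ θ → OnGraph ζ → OnGraph θ → Within 0 ζ θ → ζ ≡ θ
  Within-zero (base x) (base y) _           _           r         = cong base (Base.reach-zero r)
  Within-zero (base x) (path t) _           (_ , t≢q)   (d≤0 , _) = contradiction (NP.∣m-n∣≡0⇒m≡n (NP.n≤0⇒n≡0 d≤0)) t≢q
  Within-zero (path s) (base y) (_ , s≢q)   _           (d≤0 , _) = contradiction (NP.∣m-n∣≡0⇒m≡n (NP.n≤0⇒n≡0 d≤0)) s≢q
  Within-zero (path s) (path t) _           _           d≤0       = cong path (NP.∣m-n∣≡0⇒m≡n (NP.n≤0⇒n≡0 d≤0))

  Within-step : ∀ k ζ η θ → Within k ζ η → T (siteAdj η θ) → Within (suc k) ζ θ
  Within-step k (base x) (base z) (base y) r e = Base.reach-step k r e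
  Within-step k (base x) (base z) (path t) r e with base-path-adj z t e
  ... | refl , d rewrite NP.∣-∣-comm t q | d = s≤s z≤n , r
  Within-step k (base x) (path u) (base y) (_ , r) e with path-base-adj u y e
  ... | refl , _ = Base.reach-mono (NP.≤-trans (NP.m∸n≤m k ∣ u - q ∣) (NP.n≤1+n k)) r
  Within-step k (base x) (path u) (path t) (d≤k , r) e =
    NP.≤-trans t-q≤ (s≤s d≤k) , Base.reach-mono (NP.∸-monoʳ-≤ (suc k) t-q≤) r
    where
    t-q≤ : ∣ t - q ∣ ≤ suc ∣ u - q ∣
    t-q≤ = subst (_≤ suc ∣ u - q ∣) (NP.∣-∣-comm q t)
             (∣-∣-step q u t (NP.≤-reflexive (NP.∣-∣-comm q u)) (Equivalence.to (T-consec⇔ u t) e))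
  Within-step k (path s) (base z) (base y) (d≤k , r) e =
    NP.m≤n⇒m≤1+n d≤k ,
    subst (λ j → T (reach a j w y)) (sym (NP.+-∸-assoc 1 d≤k)) (Base.reach-step (k ∸ ∣ s - q ∣) r e)
  Within-step k (path s) (base z) (path t) (d≤k , _) e with base-path-adj z t e
  ... | refl , d = ∣-∣-step s q t d≤k d
  Within-step k (path s) (path u) (base y) d≤k e with path-base-adj u y e
  ... | refl , d = ∣-∣-step s u q d≤k d , Base.reach-refl (suc k ∸ ∣ s - q ∣) w
  Within-step k (path s) (path u) (path t) d≤k e = ∣-∣-step s u t d≤k (Equivalence.to (T-consec⇔ u t) e)

  w-path-adj : ∀ t → ∣ q - t ∣ ≡ 1 → T (siteAdj (base w) (path t))
  w-path-adj t d = Equivalence.from T-∧ (fromWitness refl , Equivalence.from (T-consec⇔ q t) d)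

  path-w-adj : ∀ s → ∣ s - q ∣ ≡ 1 → T (siteAdj (path s) (base w))
  path-w-adj s d = Equivalence.from T-∧ (fromWitness refl , Equivalence.from (T-consec⇔ s q) d)

  LastStep : ℕ → Site → Site → Set
  LastStep k ζ θ = Within k ζ θ ⊎ ∃ λ η → OnGraph η × Within k ζ η × T (siteAdj η θ)

  Within-last-step : ∀ k ζ θ → OnGraph ζ → OnGraph θ → Within (suc k) ζ θ → LastStep k ζ θ
  Within-last-step k (base x) (base y) _ _ r with Base.reach-last-step k r
  ... | inj₁ r'           = inj₁ r'
  ... | inj₂ (z , r' , e) = inj₂ (base z , tt , r' , e)
  Within-last-step k (base x) (path t) _ (t≤L , t≢q) (d≤ , r) with ∣ t - q ∣ in d≡
  ... | zero  = contradiction (NP.∣m-n∣≡0⇒m≡n d≡) t≢q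
  ... | suc j with step-toward q t j (trans (NP.∣-∣-comm q t) d≡)
  ...   | t' , q-t' , t'-t , t'≤ with t' ≟ q
  ...     | yes refl = inj₂ (base w , tt , Base.reach-mono (NP.m∸n≤m k j) r , w-path-adj t t'-t)
  ...     | no t'≢q  = inj₂ (path t' , (NP.≤-trans t'≤ (NP.⊔-lub q≤L t≤L) , t'≢q) ,
                               subst (λ d → d ≤ k × T (reach a (k ∸ d) x w)) (sym t'-q) (NP.≤-pred d≤ , r) ,
                               Equivalence.from (T-consec⇔ t' t) t'-t)
    where
    t'-q : ∣ t' - q ∣ ≡ j
    t'-q = trans (NP.∣-∣-comm t' q) q-t'
  Within-last-step k (path s) (base y) (s≤L , _) _ (d≤ , r) with NP.m≤n⇒m<n∨m≡n d≤
  ... | inj₁ d<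
    with Base.reach-last-step (k ∸ ∣ s - q ∣) (subst (λ j → T (reach a j w y)) (NP.+-∸-assoc 1 (NP.≤-pred d<)) r)
  ...   | inj₁ r'           = inj₁ (NP.≤-pred d< , r')
  ...   | inj₂ (z , r' , e) = inj₂ (base z , tt , (NP.≤-pred d< , r') , e)
  Within-last-step k (path s) (base y) (s≤L , _) _ (d≤ , r) | inj₂ d≡
    with step-toward s q k d≡
       | Base.reach-zero (subst (λ j → T (reach a j w y)) (trans (cong (suc k ∸_) d≡) (NP.n∸n≡0 (suc k))) r)
  ... | t' , s-t' , t'-q , t'≤ | refl =
    inj₂ (path t' , (NP.≤-trans t'≤ (NP.⊔-lub s≤L q≤L) , ≢q) , NP.≤-reflexive s-t' , path-w-adj t' t'-q)
    where
    ≢q : t' ≢ q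
    ≢q refl = contradiction (trans (sym (NP.∣n-n∣≡0 q)) t'-q) λ ()
  Within-last-step k (path s) (path t) (s≤L , _) (t≤L , _) d≤ with NP.m≤n⇒m<n∨m≡n d≤
  ... | inj₁ d< = inj₁ (NP.≤-pred d<)
  ... | inj₂ d≡ with step-toward s t k d≡
  ...   | t' , s-t' , t'-t , t'≤ with t' ≟ q
  ...     | yes refl = inj₂ (base w , tt , (NP.≤-reflexive s-t' , Base.reach-refl (k ∸ ∣ s - q ∣) w) ,
                               w-path-adj t t'-t)
  ...     | no t'≢q  = inj₂ (path t' , (NP.≤-trans t'≤ (NP.⊔-lub s≤L t≤L) , t'≢q) , NP.≤-reflexive s-t' ,
                               Equivalence.from (T-consec⇔ t' t) t'-t)

  module Attached = Walks A

  siteOf-onGraph : ∀ X → OnGraph (siteOf X)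
  siteOf-onGraph X = site-onGraph (kind p q X)

  siteOf-unkind : ∀ κ → siteOf (unkind κ) ≡ site κ
  siteOf-unkind κ = cong site (kind-unkind κ)

  reach⇔Within : ∀ k X Y → T (reach A k X Y) ⇔ Within k (siteOf X) (siteOf Y)
  reach⇔Within zero X Y = mk⇔
    (λ r → subst (λ Z → Within 0 (siteOf X) (siteOf Z)) (Attached.reach-zero r) (Within-refl (siteOf X)))
    (λ r → fromWitness (kind-injective (site-injective (kind p q X) (kind p q Y)
             (Within-zero (siteOf X) (siteOf Y) (siteOf-onGraph X) (siteOf-onGraph Y) r))))
  reach⇔Within (suc k) X Y = mk⇔ to from
    where
    to : T (reach A (suc k) X Y) → Within (suc k) (siteOf X) (siteOf Y)
    to r with Attached.reach-last-step k r
    ... | inj₁ r'           = Within-suc k (siteOf X) (siteOf Y) (Equivalence.to (reach⇔Within k X Y) r')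
    ... | inj₂ (Z , r' , e) = Within-step k (siteOf X) (siteOf Z) (siteOf Y) (Equivalence.to (reach⇔Within k X Z) r')
                                          (subst T (attach≡siteAdj Z Y) e)
    from : Within (suc k) (siteOf X) (siteOf Y) → T (reach A (suc k) X Y)
    from r with Within-last-step k (siteOf X) (siteOf Y) (siteOf-onGraph X) (siteOf-onGraph Y) r
    ... | inj₁ r' = Attached.reach-suc k (Equivalence.from (reach⇔Within k X Y) r')
    ... | inj₂ (η , onη , r' , e) with site-surjective η onη
    ...   | κ , refl = Attached.reach-step k
            (Equivalence.from (reach⇔Within k X (unkind κ))
               (subst (Within k (siteOf X)) (sym (siteOf-unkind κ)) r'))
            (subst T (sym (trans (attach≡siteAdj (unkind κ) Y) (cong (λ ζ → siteAdj ζ (siteOf Y)) (siteOf-unkind κ)))) e)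

  open Host a w N

  -- dist only searches walk lengths below N, hence the caps at N.
  siteDist : Site → Site → ℕ
  siteDist (base x) (base y) = baseDist x y
  siteDist (base x) (path t) = N ⊓ (∣ t - q ∣ + baseDist x w)
  siteDist (path s) (base y) = N ⊓ (∣ s - q ∣ + baseDist w y)
  siteDist (path s) (path t) = N ⊓ ∣ s - t ∣

  search-Within : ∀ ζ θ (f : ℕ → Bool) → (∀ k → T (f k) ⇔ Within k ζ θ) → search f N ≡ siteDist ζ θ
  search-Within (base x) (base y) f f⇔ =
    search-cong f _ N (Equivalence.to ∘ f⇔) (Equivalence.from ∘ f⇔)
  search-Within (base x) (path t) f f⇔ =
    search-shift f (λ k → reach a k x w) ∣ t - q ∣ N (Equivalence.to ∘ f⇔) (λ k d≤k r → Equivalence.from (f⇔ k) (d≤k , r))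
  search-Within (path s) (base y) f f⇔ =
    search-shift f (λ k → reach a k w y) ∣ s - q ∣ N (Equivalence.to ∘ f⇔) (λ k d≤k r → Equivalence.from (f⇔ k) (d≤k , r))
  search-Within (path s) (path t) f f⇔ =
    trans (search-threshold f ∣ s - t ∣ N (Equivalence.to ∘ f⇔) (Equivalence.from ∘ f⇔)) (NP.⊓-comm ∣ s - t ∣ N)

  dist≡siteDist : ∀ X Y → dist A X Y ≡ siteDist (siteOf X) (siteOf Y)
  dist≡siteDist X Y = search-Within (siteOf X) (siteOf Y) (λ k → reach A k X Y) (λ k → reach⇔Within k X Y)

  module SiteSum {B : Set} {_∙_ : B → B → B} {ε : B} (isCM : IsCommutativeMonoid _≡_ _∙_ ε) where
    open FiniteSum isCM
    open IsCommutativeMonoid isCM using (assoc; comm)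

    sum-siteOf : ∀ (h : Site → B) →
                 sum (h ∘ siteOf) ≡ sum (h ∘ base) ∙ (sum (h ∘ path ∘ posv) ∙ sum (h ∘ path ∘ posu))
    sum-siteOf h = trans (sum-↑ n L (h ∘ siteOf))
      (cong₂ _∙_ (sum-cong-≗ (λ x → cong (h ∘ site) (kind-unkind (old x))))
         (trans (sum-↑ p q (λ r → h (siteOf (n ↑ʳ r))))
            (cong₂ _∙_ (sum-cong-≗ (λ i → cong (h ∘ site) (kind-unkind (vv i))))
                       (sum-cong-≗ (λ j → cong (h ∘ site) (kind-unkind (uu j)))))))

    sum-line : ∀ (g : ℕ → B) → g q ∙ (sum (g ∘ posv) ∙ sum (g ∘ posu)) ≡ sum< (suc L) g
    sum-line g = begin
        g q ∙ (sum< p (λ i → g (suc (q + i))) ∙ sum< q (λ j → g (q ∸ suc j)))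
      ≡⟨ cong (λ t → g q ∙ (sum< p (λ i → g (suc (q + i))) ∙ t)) (sum<-reverse q g) ⟩
        g q ∙ (sum< p (λ i → g (suc (q + i))) ∙ sum< q g)
      ≡⟨ assoc _ _ _ ⟨
        (g q ∙ sum< p (λ i → g (suc (q + i)))) ∙ sum< q g
      ≡⟨ comm _ _ ⟩
        sum< q g ∙ (g q ∙ sum< p (λ i → g (suc (q + i))))
      ≡⟨ cong₂ (λ u v → sum< q g ∙ (g u ∙ v)) (NP.+-identityʳ q) (sum<-cong p (λ i _ → cong g (NP.+-suc q i))) ⟨
        sum< q g ∙ sum< (suc p) (λ i → g (q + i))
      ≡⟨ sum<-+ q (suc p) g ⟨
        sum< (q + suc p) g
      ≡⟨ cong (λ t → sum< t g) (trans (NP.+-suc q p) (cong suc (NP.+-comm q p))) ⟩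
        sum< (suc L) g ∎
      where open ≡-Reasoning

  module MaxSite = SiteSum NP.⊔-0-isCommutativeMonoid
  module ΣℕSite = SiteSum NP.+-0-isCommutativeMonoid
  module ΣℚSite = SiteSum ℚP.+-0-isCommutativeMonoid

  siteEcc : Site → ℕ
  siteEcc ζ = Max.sum (λ Y → siteDist ζ (siteOf Y))

  ecc≡siteEcc : ∀ X → ecc A X ≡ siteEcc (siteOf X)
  ecc≡siteEcc X = trans (Max.foldr-allFin (dist A X)) (Max.sum-cong-≗ (dist≡siteDist X))

  private
    L∸q≡p : L ∸ q ≡ p
    L∸q≡p = NP.m+n∸n≡m p q

    ⊓-+-mono : ∀ d {x y} → x ≤ y → N ⊓ (x + d) ≤ N ⊓ (y + d)
    ⊓-+-mono d x≤y = NP.⊓-monoʳ-≤ N (NP.+-monoˡ-≤ d x≤y)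

  siteEcc-base : ∀ x → siteEcc (base x) ≡ baseEcc (q ⊔ p) x
  siteEcc-base x = begin
      siteEcc (base x)
    ≡⟨ MaxSite.sum-siteOf (siteDist (base x)) ⟩
      Max.sum (baseDist x) ⊔ (Max.sum (g ∘ posv) ⊔ Max.sum (g ∘ posu))
    ≡⟨ ⊔-absorbs (Max.sum (g ∘ posv) ⊔ Max.sum (g ∘ posu)) g-q≤ ⟩
      Max.sum (baseDist x) ⊔ (g q ⊔ (Max.sum (g ∘ posv) ⊔ Max.sum (g ∘ posu)))
    ≡⟨ cong (Max.sum (baseDist x) ⊔_) (MaxSite.sum-line g) ⟩
      Max.sum (baseDist x) ⊔ Max.sum< (suc L) g
    ≡⟨ cong (Max.sum (baseDist x) ⊔_) (max-distrib (⊓-+-mono (baseDist x w)) {suc L} F.zero (λ t → ∣ toℕ t - q ∣)) ⟩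
      Max.sum (baseDist x) ⊔ (N ⊓ (Max.sum< (suc L) (λ t → ∣ t - q ∣) + baseDist x w))
    ≡⟨ cong (λ u → Max.sum (baseDist x) ⊔ (N ⊓ (u + baseDist x w))) (trans (max<-∣-∣ q≤L) (cong (q ⊔_) L∸q≡p)) ⟩
      baseEcc (q ⊔ p) x ∎
    where
    open ≡-Reasoning
    g : ℕ → ℕ
    g t = N ⊓ (∣ t - q ∣ + baseDist x w)
    g-q≤ : g q ≤ Max.sum (baseDist x)
    g-q≤ = NP.≤-trans (NP.m⊓n≤n N (∣ q - q ∣ + baseDist x w))
             (subst (λ u → u + baseDist x w ≤ Max.sum (baseDist x)) (sym (NP.∣n-n∣≡0 q)) (max-upper (baseDist x) w))

  siteEcc-path : ∀ s → s ≤ L → siteEcc (path s) ≡ lineEcc N L hostEcc q s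
  siteEcc-path s s≤L = begin
      siteEcc (path s)
    ≡⟨ MaxSite.sum-siteOf (siteDist (path s)) ⟩
      Max.sum (λ y → N ⊓ (∣ s - q ∣ + baseDist w y)) ⊔ (Max.sum (g ∘ posv) ⊔ Max.sum (g ∘ posu))
    ≡⟨ cong (_⊔ (Max.sum (g ∘ posv) ⊔ Max.sum (g ∘ posu)))
            (max-distrib (NP.⊓-monoʳ-≤ N ∘ NP.+-monoʳ-≤ ∣ s - q ∣) w (baseDist w)) ⟩
      toHost ⊔ (Max.sum (g ∘ posv) ⊔ Max.sum (g ∘ posu))
    ≡⟨ ⊔-absorbs (Max.sum (g ∘ posv) ⊔ Max.sum (g ∘ posu)) (NP.⊓-monoʳ-≤ N (NP.m≤m+n ∣ s - q ∣ hostEcc)) ⟩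
      toHost ⊔ (g q ⊔ (Max.sum (g ∘ posv) ⊔ Max.sum (g ∘ posu)))
    ≡⟨ cong (toHost ⊔_) (MaxSite.sum-line g) ⟩
      toHost ⊔ Max.sum< (suc L) g
    ≡⟨ cong (toHost ⊔_) (max-distrib (NP.⊓-monoʳ-≤ N) {suc L} F.zero (λ t → ∣ s - toℕ t ∣)) ⟩
      toHost ⊔ (N ⊓ Max.sum< (suc L) (λ t → ∣ s - t ∣))
    ≡⟨ cong (λ u → toHost ⊔ (N ⊓ u)) (trans (Max.sum<-cong (suc L) (λ t _ → NP.∣-∣-comm s t)) (max<-∣-∣ s≤L)) ⟩
      lineEcc N L hostEcc q s ∎
    where
    open ≡-Reasoning
    g : ℕ → ℕ
    g t = N ⊓ ∣ s - t ∣
    toHost : ℕ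
    toHost = N ⊓ (∣ s - q ∣ + hostEcc)

  siteDeg : Site → ℕ
  siteDeg ζ = Σℕ.sum (λ Y → indicator (siteAdj ζ (siteOf Y)))

  deg≡siteDeg : ∀ X → deg A X ≡ siteDeg (siteOf X)
  deg≡siteDeg X = trans (Σℕ.foldr-allFin (indicator ∘ A X))
                        (Σℕ.sum-cong-≗ (λ Y → cong indicator (attach≡siteAdj X Y)))

  extraDeg : Fin n → ℕ
  extraDeg x = if ⌊ x FP.≟ w ⌋ then pathDeg L q else 0

  siteDeg-base : ∀ x → siteDeg (base x) ≡ deg a x + extraDeg x
  siteDeg-base x = begin
      siteDeg (base x)
    ≡⟨ ΣℕSite.sum-siteOf (λ θ → indicator (siteAdj (base x) θ)) ⟩
      Σℕ.sum (indicator ∘ a x) + (Σℕ.sum (g ∘ posv) + Σℕ.sum (g ∘ posu))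
    ≡⟨ cong₂ (λ d e → d + (indicator e + (Σℕ.sum (g ∘ posv) + Σℕ.sum (g ∘ posu))))
             (Σℕ.foldr-allFin (indicator ∘ a x))
             (trans (cong (⌊ x FP.≟ w ⌋ ∧_) (consec-irrefl q)) (∧-zeroʳ _)) ⟨
      deg a x + (g q + (Σℕ.sum (g ∘ posv) + Σℕ.sum (g ∘ posu)))
    ≡⟨ cong (deg a x +_) (ΣℕSite.sum-line g) ⟩
      deg a x + Σℕ.sum< (suc L) g
    ≡⟨ cong (deg a x +_) (extra ⌊ x FP.≟ w ⌋) ⟩
      deg a x + extraDeg x ∎
    where
    open ≡-Reasoning
    g : ℕ → ℕ
    g t = indicator (⌊ x FP.≟ w ⌋ ∧ consec q t)
    extra : ∀ b → Σℕ.sum< (suc L) (λ t → indicator (b ∧ consec q t)) ≡ (if b then pathDeg L q else 0)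
    extra true  = refl
    extra false = Σℕ.sum-replicate-zero (suc L)

  siteDeg-path : ∀ s → siteDeg (path s) ≡ pathDeg L s
  siteDeg-path s = begin
      siteDeg (path s)
    ≡⟨ ΣℕSite.sum-siteOf (λ θ → indicator (siteAdj (path s) θ)) ⟩
      Σℕ.sum (λ y → indicator (⌊ y FP.≟ w ⌋ ∧ consec s q)) + (Σℕ.sum (g ∘ posv) + Σℕ.sum (g ∘ posu))
    ≡⟨ cong (_+ (Σℕ.sum (g ∘ posv) + Σℕ.sum (g ∘ posu))) only-w ⟩
      g q + (Σℕ.sum (g ∘ posv) + Σℕ.sum (g ∘ posu))
    ≡⟨ ΣℕSite.sum-line g ⟩
      pathDeg L s ∎
    where
    open ≡-Reasoning
    g : ℕ → ℕ
    g t = indicator (consec s t)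
    only-w : Σℕ.sum (λ y → indicator (⌊ y FP.≟ w ⌋ ∧ consec s q)) ≡ g q
    only-w = trans (Σℕ.sum-concentrated _ w (λ y y≢w → cong (λ b → indicator (b ∧ consec s q))
                                                         (¬T⇒≡false (y≢w ∘ toWitness))))
                   (cong (λ b → indicator (b ∧ consec s q)) (T-injective {⌊ w FP.≟ w ⌋} {true} _ (λ _ → fromWitness refl)))

  private
    baseDist-refl : baseDist w w ≡ 0
    baseDist-refl = search-threshold _ 0 N (λ _ _ → z≤n) (λ k _ → Base.reach-refl k w)

    hostEcc≤N : hostEcc ≤ N
    hostEcc≤N = max-least (baseDist w) (λ y → search-≤ _ N)

  baseEcc-w : baseEcc (q ⊔ p) w ≡ lineEcc N L hostEcc q q
  baseEcc-w = begin
      hostEcc ⊔ (N ⊓ ((q ⊔ p) + baseDist w w))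
    ≡⟨ cong (λ d → hostEcc ⊔ (N ⊓ ((q ⊔ p) + d))) baseDist-refl ⟩
      hostEcc ⊔ (N ⊓ ((q ⊔ p) + 0))
    ≡⟨ cong₂ (λ u v → u ⊔ (N ⊓ v)) (NP.m≥n⇒m⊓n≡n hostEcc≤N)
             (trans (cong (q ⊔_) L∸q≡p) (sym (NP.+-identityʳ (q ⊔ p)))) ⟨
      (N ⊓ hostEcc) ⊔ (N ⊓ (q ⊔ (L ∸ q)))
    ≡⟨ cong (λ u → (N ⊓ (u + hostEcc)) ⊔ (N ⊓ (q ⊔ (L ∸ q)))) (NP.∣n-n∣≡0 q) ⟨
      lineEcc N L hostEcc q q ∎
    where open ≡-Reasoning

  ξce-decomposition : ξce A ≡ baseSum (q ⊔ p) ℚ.+ lineSum N L hostEcc q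
  ξce-decomposition = begin
      ξce A
    ≡⟨ Σℚ.foldr-allFin (λ X → frac (deg A X) (ecc A X)) ⟩
      Σℚ.sum (λ X → frac (deg A X) (ecc A X))
    ≡⟨ Σℚ.sum-cong-≗ (λ X → cong₂ frac (deg≡siteDeg X) (ecc≡siteEcc X)) ⟩
      Σℚ.sum (term ∘ siteOf)
    ≡⟨ ΣℚSite.sum-siteOf term ⟩
      Σℚ.sum (term ∘ base) ℚ.+ (Σℚ.sum (term ∘ path ∘ posv) ℚ.+ Σℚ.sum (term ∘ path ∘ posu))
    ≡⟨ cong₂ ℚ._+_ base-terms (cong₂ ℚ._+_ (Σℚ.sum-cong-≗ (λ i → path-term (posv i) (posv≤L i)))
                                            (Σℚ.sum-cong-≗ (λ j → path-term (posu j) (posu≤L j)))) ⟩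
      (baseSum (q ⊔ p) ℚ.+ G q) ℚ.+ (Σℚ.sum (G ∘ posv) ℚ.+ Σℚ.sum (G ∘ posu))
    ≡⟨ ℚP.+-assoc (baseSum (q ⊔ p)) (G q) _ ⟩
      baseSum (q ⊔ p) ℚ.+ (G q ℚ.+ (Σℚ.sum (G ∘ posv) ℚ.+ Σℚ.sum (G ∘ posu)))
    ≡⟨ cong (baseSum (q ⊔ p) ℚ.+_) (ΣℚSite.sum-line G) ⟩
      baseSum (q ⊔ p) ℚ.+ lineSum N L hostEcc q ∎
    where
    open ≡-Reasoning
    term : Site → ℚ
    term ζ = frac (siteDeg ζ) (siteEcc ζ)
    G : ℕ → ℚ
    G = lineTerm N L hostEcc q
    path-term : ∀ s → s ≤ L → term (path s) ≡ G s
    path-term s s≤L = cong₂ frac (siteDeg-path s) (siteEcc-path s s≤L)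
    f : Fin n → ℚ
    f x = frac (deg a x) (baseEcc (q ⊔ p) x)
    extra-term : ∀ x → x ≢ w → frac (extraDeg x) (baseEcc (q ⊔ p) x) ≡ 0ℚ
    extra-term x x≢w = trans (cong (λ b → frac (if b then pathDeg L q else 0) (baseEcc (q ⊔ p) x))
                                   (¬T⇒≡false (x≢w ∘ toWitness)))
                             (frac-0 (baseEcc (q ⊔ p) x))
    base-terms : Σℚ.sum (term ∘ base) ≡ baseSum (q ⊔ p) ℚ.+ G q
    base-terms = begin
        Σℚ.sum (term ∘ base)
      ≡⟨ Σℚ.sum-cong-≗ (λ x → trans (cong₂ frac (siteDeg-base x) (siteEcc-base x))
                                    (frac-+ (deg a x) (extraDeg x) (baseEcc (q ⊔ p) x))) ⟩
        Σℚ.sum (λ x → f x ℚ.+ frac (extraDeg x) (baseEcc (q ⊔ p) x))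
      ≡⟨ Σℚ.∑-distrib-+ f (λ x → frac (extraDeg x) (baseEcc (q ⊔ p) x)) ⟩
        baseSum (q ⊔ p) ℚ.+ Σℚ.sum (λ x → frac (extraDeg x) (baseEcc (q ⊔ p) x))
      ≡⟨ cong (baseSum (q ⊔ p) ℚ.+_) (Σℚ.sum-concentrated _ w extra-term) ⟩
        baseSum (q ⊔ p) ℚ.+ frac (extraDeg w) (baseEcc (q ⊔ p) w)
      ≡⟨ cong (baseSum (q ⊔ p) ℚ.+_) (cong₂ frac extraDeg-w baseEcc-w) ⟩
        baseSum (q ⊔ p) ℚ.+ G q ∎
      where
      extraDeg-w : extraDeg w ≡ pathDeg L q
      extraDeg-w = cong (λ b → if b then pathDeg L q else 0) (T-injective {⌊ w FP.≟ w ⌋} {true} _ (λ _ → fromWitness refl))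

frac-exchange : ∀ {d d' a b K K'} → d ≤ d' → a ≤ b → K ≤ K' → 1 ≤ a →
                frac d (K ⊔ b) ℚ.+ frac d' (K' ⊔ a) ℚ.≤ frac d (K' ⊔ b) ℚ.+ frac d' (K ⊔ a)
frac-exchange {d} {d'} {a} {b} {K} {K'} d≤d' a≤b K≤K' 1≤a with NP.≤-total K' b
... | inj₁ K'≤b rewrite NP.m≤n⇒m⊔n≡n K'≤b | NP.m≤n⇒m⊔n≡n (NP.≤-trans K≤K' K'≤b) =
  ℚP.+-monoʳ-≤ (frac d b) (frac-antitone d' (NP.≤-trans 1≤a (NP.m≤n⊔m K a)) (NP.⊔-monoˡ-≤ a K≤K'))
... | inj₂ b≤K' with NP.m≤n⇒∃[o]m+o≡n d≤d'
...   | e , refl rewrite NP.m≥n⇒m⊔n≡m b≤K' | NP.m≥n⇒m⊔n≡m (NP.≤-trans a≤b b≤K') = begin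
    frac d (K ⊔ b) ℚ.+ frac (d + e) K'                 ≡⟨ cong (frac d (K ⊔ b) ℚ.+_) (frac-+ d e K') ⟩
    frac d (K ⊔ b) ℚ.+ (frac d K' ℚ.+ frac e K')       ≤⟨ ℚP.+-mono-≤ (frac-antitone d 1≤K⊔a (NP.⊔-monoʳ-≤ K a≤b))
                                                            (ℚP.+-monoʳ-≤ (frac d K')
                                                              (frac-antitone e 1≤K⊔a (NP.⊔-lub K≤K' (NP.≤-trans a≤b b≤K')))) ⟩
    frac d (K ⊔ a) ℚ.+ (frac d K' ℚ.+ frac e (K ⊔ a))  ≡⟨ swap-first (frac d (K ⊔ a)) (frac d K') (frac e (K ⊔ a)) ⟩
    frac d K' ℚ.+ (frac d (K ⊔ a) ℚ.+ frac e (K ⊔ a))  ≡⟨ cong (frac d K' ℚ.+_) (frac-+ d e (K ⊔ a)) ⟨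
    frac d K' ℚ.+ frac (d + e) (K ⊔ a)                 ∎
  where
  open ℚP.≤-Reasoning
  1≤K⊔a : 1 ≤ K ⊔ a
  1≤K⊔a = NP.≤-trans 1≤a (NP.m≤n⊔m K a)
  swap-first : ∀ x y z → x ℚ.+ (y ℚ.+ z) ≡ y ℚ.+ (x ℚ.+ z)
  swap-first x y z = trans (sym (ℚP.+-assoc x y z))
                       (trans (cong (ℚ._+ z) (ℚP.+-comm x y)) (ℚP.+-assoc y x z))

lineEcc-pos : ∀ N L m c {s} → 1 ≤ N → 1 ≤ s → 1 ≤ lineEcc N L m c s
lineEcc-pos N L m c {s} 1≤N 1≤s = NP.≤-trans (NP.⊓-glb 1≤N (NP.≤-trans 1≤s (NP.m≤m⊔n s (L ∸ s)))) (NP.m≤n⊔m _ _)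

lineEcc-mono : ∀ N L m {c c'} s → ∣ s - c ∣ ≤ ∣ s - c' ∣ → lineEcc N L m c s ≤ lineEcc N L m c' s
lineEcc-mono N L m s ≤ = NP.⊔-monoˡ-≤ (N ⊓ (s ⊔ (L ∸ s))) (NP.⊓-monoʳ-≤ N (NP.+-monoˡ-≤ m ≤))

private
  ∣m-m+n∣≡n′ : ∀ m n → ∣ m + n - m ∣ ≡ n
  ∣m-m+n∣≡n′ m n = trans (NP.∣-∣-comm (m + n) m) (NP.∣m-m+n∣≡n m n)

  ∣1+m+n-m∣ : ∀ m n → ∣ suc m + n - m ∣ ≡ suc n
  ∣1+m+n-m∣ m n = trans (cong (λ t → ∣ t - m ∣) (sym (NP.+-suc m n))) (∣m-m+n∣≡n′ m (suc n))

  ∣s-1+q∣ : ∀ {s q} → s ≤ q → ∣ s - suc q ∣ ≡ suc (q ∸ s)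
  ∣s-1+q∣ {s} s≤q = trans (NP.m≤n⇒∣m-n∣≡n∸m (NP.m≤n⇒m≤1+n s≤q)) (NP.+-∸-assoc 1 s≤q)

-- c + (c ∸ suc s) = 2q + 1 − s is the mirror image of s about the midpoint of q and q + 1.
lineSum-recentre : ∀ N m q r → 1 ≤ N →
                   lineSum N (suc q + r + suc q) m q ℚ.≤ lineSum N (suc q + r + suc q) m (suc q)
lineSum-recentre N m q r 1≤N = subst₂ ℚ._≤_ (sym (fold (term q))) (sym (fold (term c)))
  (ℚP.+-mono-≤ (Σℚ<-mono c _ _ (λ s s<c → pair s (NP.≤-pred s<c))) (Σℚ<-mono (suc r) _ _ (λ i _ → far i)))
  where
  c L : ℕ
  c = suc q
  L = c + r + c

  term : ℕ → ℕ → ℚ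
  term = lineTerm N L m

  fold : ∀ g → Σℚ.sum< (suc L) g ≡ Σℚ.sum< c (λ s → g s ℚ.+ g (c + (c ∸ suc s))) ℚ.+ Σℚ.sum< (suc r) (λ i → g (c + (c + i)))
  fold g = trans (cong (λ k → Σℚ.sum< k g) length) (Σℚ.sum<-mirror c (suc r) g)
    where
    length : suc L ≡ c + (c + suc r)
    length = trans (cong suc (NP.+-assoc c r c))
               (trans (sym (NP.+-suc c (r + c))) (cong (c +_) (trans (cong suc (NP.+-comm r c)) (sym (NP.+-suc c r)))))

  far : ∀ i → term q (c + (c + i)) ℚ.≤ term c (c + (c + i))
  far i = frac-antitone (pathDeg L x) (lineEcc-pos N L m c {x} 1≤N (s≤s z≤n))
            (lineEcc-mono N L m {c} {q} x (subst₂ _≤_ (sym (∣m-m+n∣≡n′ c (c + i))) (sym (∣1+m+n-m∣ q (c + i))) (NP.n≤1+n _)))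
    where x = c + (c + i)

  pair : ∀ s → s ≤ q → term q s ℚ.+ term q (c + (c ∸ suc s)) ℚ.≤ term c s ℚ.+ term c (c + (c ∸ suc s))
  pair s s≤q = subst₂ ℚ._≤_
      (cong₂ ℚ._+_ (cong (λ u → frac (pathDeg L s) ((N ⊓ (u + m)) ⊔ b)) (sym (NP.m≤n⇒∣m-n∣≡n∸m s≤q)))
                   (cong (λ u → frac (pathDeg L s') ((N ⊓ (u + m)) ⊔ a)) (sym (∣1+m+n-m∣ q x))))
      (cong₂ ℚ._+_ (cong (λ u → frac (pathDeg L s) ((N ⊓ (u + m)) ⊔ b)) (sym (∣s-1+q∣ s≤q)))
                   (cong (λ u → frac (pathDeg L s') ((N ⊓ (u + m)) ⊔ a)) (sym (∣m-m+n∣≡n′ c x))))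
      (frac-exchange d≤d' a≤b (NP.⊓-monoʳ-≤ N (NP.+-monoˡ-≤ m (NP.n≤1+n x))) 1≤a)
    where
    x s' a b : ℕ
    x  = q ∸ s
    s' = c + x
    a  = N ⊓ (s' ⊔ (L ∸ s'))
    b  = N ⊓ (s ⊔ (L ∸ s))
    s'<L : s' < L
    s'<L = subst (s' <_) (sym (NP.+-assoc c r c))
             (NP.+-monoʳ-< c (NP.≤-trans (s≤s (NP.m∸n≤m q s)) (NP.m≤n+m c r)))
    d≤d' : pathDeg L s ≤ pathDeg L s'
    d≤d' = NP.≤-trans (pathDeg-≤2 L s) (pathDeg-interior L s' (s≤s z≤n) s'<L)
    1≤a : 1 ≤ a
    1≤a = NP.⊓-glb 1≤N (NP.≤-trans (s≤s z≤n) (NP.m≤m⊔n s' (L ∸ s')))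
    s+s'≤L : s + s' ≤ L
    s+s'≤L = begin
      s + (c + x)   ≡⟨ NP.+-assoc s c x ⟨
      (s + c) + x   ≡⟨ cong (_+ x) (NP.+-comm s c) ⟩
      (c + s) + x   ≡⟨ NP.+-assoc c s x ⟩
      c + (s + x)   ≡⟨ cong (c +_) (NP.m+[n∸m]≡n s≤q) ⟩
      c + q         ≤⟨ NP.+-monoʳ-≤ c (NP.≤-trans (NP.n≤1+n q) (NP.m≤n+m c r)) ⟩
      c + (r + c)   ≡⟨ NP.+-assoc c r c ⟨
      L             ∎
      where open NP.≤-Reasoning
    a≤b : a ≤ b
    a≤b = NP.⊓-monoʳ-≤ N (NP.≤-trans
      (NP.⊔-lub (subst (_≤ L ∸ s) (NP.m+n∸m≡n s s') (NP.∸-monoˡ-≤ s s+s'≤L))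
                (NP.∸-monoʳ-≤ L (NP.≤-trans s≤q (NP.≤-trans (NP.n≤1+n q) (NP.m≤m+n c x)))))
      (NP.m≤n⊔m s (L ∸ s)))

lemma2p2 : (n : ℕ) (a : Adj n) → Symmetric a → Loopless a → Connected a → 2 ≤ n →
           (w : Fin n) (p q : ℕ) → suc q ≤ p →
           ξce (attach a w p (suc q)) ≥ ξce (attach a w (suc p) q)
lemma2p2 n a _ _ _ _ w p q q<p with NP.m≤n⇒∃[o]m+o≡n q<p
... | r , refl = begin
    ξce (attach a w (suc p) q)                               ≡⟨ Pendant.ξce-decomposition a w (suc p) q ⟩
    decomposed (suc p + q) (q ⊔ suc p) q                     ≡⟨ cong (λ L → decomposed L (q ⊔ suc p) q) (NP.+-suc p q) ⟨
    baseSum (q ⊔ suc p) ℚ.+ lineSum N L hostEcc q            ≤⟨ ℚP.+-mono-≤ (baseSum-antitone 1≤N (NP.≤-trans (s≤s z≤n) (NP.m≤m⊔n (suc q) p)) arms)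
                                                                            (lineSum-recentre N hostEcc q r 1≤N) ⟩
    baseSum (suc q ⊔ p) ℚ.+ lineSum N L hostEcc (suc q)      ≡⟨ Pendant.ξce-decomposition a w p (suc q) ⟨
    ξce (attach a w p (suc q))                               ∎
  where
  open ℚP.≤-Reasoning
  L N : ℕ
  L = p + suc q
  N = n + L
  open Host a w N
  decomposed : ℕ → ℕ → ℕ → ℚ.ℚ
  decomposed L' ℓ c = Host.baseSum a w (n + L') ℓ ℚ.+ lineSum (n + L') L' (Host.hostEcc a w (n + L')) c
  1≤N : 1 ≤ N
  1≤N = NP.≤-trans (s≤s z≤n) (NP.m≤n+m L n)
  arms : suc q ⊔ p ≤ q ⊔ suc p
  arms = NP.⊔-lub (NP.≤-trans q<p (NP.≤-trans (NP.n≤1+n p) (NP.m≤n⊔m q (suc p))))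
                  (NP.≤-trans (NP.n≤1+n p) (NP.m≤n⊔m q (suc p)))
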